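{- Let $D=(X,\mathcal{B})$ be a $2$-$(v,k,\lambda)$ design with replication number $r=\frac{\lambda(v-1)}{k-1}$, and let $P\subseteq X$ with $|P|\leq \left\lceil \frac{r}{\lambda}\right\rceil-1$. Then $I_P$ is a dominating set of $G_D$. In particular, when $\lambda=1$, $I_P$ is a dominating set of $G_D$ whenever $|P|\leq r-1$.
   Context: Let $v,k,\lambda$ be positive integers with $v\geq k\geq 2$. A $2$-$(v,k,\lambda)$ design $D=(X,\mathcal{B})$ consists of a set $X$ of $v$ points and a family $\mathcal{B}$ of $k$-subsets of $X$ (blocks) such that every pair of distinct points is contained in exactly $\lambda$ blocks; every point then lies in exactly $r=\lambda(v-1)/(k-1)$ blocks. The incidence graph $G_D$ is the bipartite graph with vertex set $X\cup\mathcal{B}$ in which a point $x$ is adjacent to a block $B$ iff $x\in B$. A dominating set of a graph is a set $S$ of vertices such that every vertex not in $S$ is adjacent to some vertex of $S$. For $P\subseteq X$, $\hat{L}(P)=\{B\in\mathcal{B}: B\cap P=\emptyset\}$ and $I_P=P\cup\hat{L}(P)$. -}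

module Defs where

open import Data.Nat using (ℕ; zero; suc; _+_; _*_; _∸_; _≤_)
open import Data.Nat.DivMod using (_/_)
open import Data.Bool using (Bool; _∧_)
open import Data.Fin using (Fin)
open import Data.Fin.Subset using (Subset; _∈_; _∩_; ∣_∣; Empty)
open import Data.Vec using (lookup; tabulate)
open import Data.Sum using (_⊎_; inj₁; inj₂)
open import Data.Product using (∃; _×_)
open import Data.Empty using (⊥)
open import Relation.Binary.PropositionalEquality using (_≡_)

-- A 2-(v,k,λ) design: points are Fin v, the blocks form a family
-- (repetitions allowed) indexed by Fin b, each block a k-subset of the points,
-- and every pair of distinct points lies in exactly λ blocks.
record Design (v k lam : ℕ) : Set where
  field
    k≥2     : 2 ≤ k
    lam≥1     : 1 ≤ lam
    k≤v     : k ≤ v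
    b       : ℕ
    block   : Fin b → Subset v
    blockSize : ∀ i → ∣ block i ∣ ≡ k
  blocksThrough : Fin v → Fin v → Subset b
  blocksThrough x y = tabulate (λ i → lookup (block i) x ∧ lookup (block i) y)
  field
    balanced : ∀ x y → (x ≡ y → ⊥) → ∣ blocksThrough x y ∣ ≡ lam

-- natural-number division and ceiling division (divisor 0 never occurs
-- for designs, since k ≥ 2 and λ ≥ 1)
div : ℕ → ℕ → ℕ
div m zero    = 0
div m (suc n) = m / suc n

ceilDiv : ℕ → ℕ → ℕ
ceilDiv m zero    = 0
ceilDiv m (suc n) = (m + n) / suc n

replication : (v k lam : ℕ) → ℕ
replication v k lam = div (lam * (v ∸ 1)) (k ∸ 1)

module _ {v k lam : ℕ} (D : Design v k lam) where
  open Design D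

  Vertex : Set
  Vertex = Fin v ⊎ Fin b

  Adj : Vertex → Vertex → Set
  Adj (inj₁ x) (inj₁ y) = ⊥
  Adj (inj₁ x) (inj₂ i) = x ∈ block i
  Adj (inj₂ i) (inj₁ x) = x ∈ block i
  Adj (inj₂ i) (inj₂ j) = ⊥

  Dominating : (Vertex → Set) → Set
  Dominating S = ∀ u → S u ⊎ ∃ (λ w → S w × Adj u w)

  I : Subset v → Vertex → Set
  I P (inj₁ x) = x ∈ P
  I P (inj₂ i) = Empty (block i ∩ P)

-- A point x outside P that is not dominated lies only on blocks meeting P.
-- Double counting the flags (B, p) with x ∈ B and p ∈ B ∩ P then bounds
-- its replication number by |P|·λ, since each p ∈ P shares exactly λ blocks
-- with x; this contradicts |P| < ⌈r/λ⌉. Blocks are dominated trivially: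
-- either they avoid P, or they contain a point of P.
module Submission where

open import Defs
open import Data.Nat using (ℕ; _≤_; _∸_)
open import Data.Fin.Subset using (Subset; ∣_∣)
open import Data.Product using (_×_)
open import Relation.Binary.PropositionalEquality using (_≡_)

open import Data.Bool using (Bool; true; false; _∧_)
open import Data.Bool.Properties using (∧-idem)
open import Data.Empty using (⊥-elim)
open import Data.Fin as Fin using (Fin; punchIn)
open import Data.Fin.Properties using (any?; punchInᵢ≢i)
open import Data.Fin.Subset using (_∈_; _∉_; _∩_; Nonempty)
open import Data.Fin.Subset.Properties using (_∈?_; nonempty?; x∈p∩q⁻)
open import Data.Nat using (suc; _+_; _*_; _<_; z≤n; s≤s)
open import Data.Nat.DivMod using (n/1≡n; m*n/n≡m; m/n*n≤m; m≥n⇒m/n>0)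
open import Data.Nat.Properties
open import Data.Product using (∃; _,_; proj₁; proj₂)
open import Data.Sum using (inj₁; inj₂)
open import Function using (_∘_)
open import Data.Vec using ([]; _∷_; lookup)
open import Data.Vec.Properties using ([]=⇒lookup; lookup⇒[]=; lookup∘tabulate)
open import Relation.Nullary.Decidable using (yes; no; ¬?; _×-dec_; decidable-stable)
open import Relation.Binary.PropositionalEquality using (_≢_; refl; sym; trans; cong; cong₂; subst; module ≡-Reasoning)

open import Algebra.Properties.Semiring.Sum +-*-semiring
  using (sum; sum-syntax; sum-cong-≗; sum-remove; ∑-comm; *-distribˡ-sum; *-distribʳ-sum)

indicator : Bool → ℕ
indicator true  = 1
indicator false = 0

indicator-∧ : ∀ a c → indicator (a ∧ c) ≡ indicator a * indicator c
indicator-∧ true  c = sym (+-identityʳ (indicator c))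
indicator-∧ false c = refl

∣p∣≡∑indicator : ∀ {n} (p : Subset n) → ∣ p ∣ ≡ ∑[ i < n ] indicator (lookup p i)
∣p∣≡∑indicator []          = refl
∣p∣≡∑indicator (true ∷ p)  = cong suc (∣p∣≡∑indicator p)
∣p∣≡∑indicator (false ∷ p) = ∣p∣≡∑indicator p

sum-const : ∀ n c → ∑[ i < n ] c ≡ n * c
sum-const 0       c = refl
sum-const (suc n) c = cong (c +_) (sum-const n c)

sum-mono-≤ : ∀ {n} {f g : Fin n → ℕ} → (∀ i → f i ≤ g i) → sum f ≤ sum g
sum-mono-≤ {0}     f≤g = z≤n
sum-mono-≤ {suc n} f≤g = +-mono-≤ (f≤g _) (sum-mono-≤ (λ i → f≤g (Fin.suc i)))

term≤sum : ∀ {n} (f : Fin n → ℕ) i → f i ≤ sum f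
term≤sum f Fin.zero    = m≤m+n _ _
term≤sum f (Fin.suc i) = ≤-trans (term≤sum (λ j → f (Fin.suc j)) i) (m≤n+m _ _)

indicator≤sum : ∀ {n} c (f : Fin n → ℕ) → (c ≡ true → ∃ λ i → f i ≡ 1) → indicator c ≤ sum f
indicator≤sum false f _       = z≤n
indicator≤sum true  f witness = let i , fᵢ≡1 = witness refl in subst (_≤ sum f) fᵢ≡1 (term≤sum f i)

sum-constExcept : ∀ {n} (f : Fin n → ℕ) i c → (∀ j → j ≢ i → f j ≡ c) →
                  sum f ≡ f i + (n ∸ 1) * c
sum-constExcept {suc n} f i c f≡c = begin
  sum f                             ≡⟨ sum-remove f ⟩
  f i + ∑[ j < n ] f (punchIn i j)  ≡⟨ cong (f i +_) (sum-cong-≗ (λ j → f≡c _ (punchInᵢ≢i i j))) ⟩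
  f i + ∑[ j < n ] c                ≡⟨ cong (f i +_) (sum-const n c) ⟩
  f i + n * c                       ∎
  where open ≡-Reasoning

div-*-cancelʳ : ∀ m {n} → 1 ≤ n → div (m * n) n ≡ m
div-*-cancelʳ m {suc n} _ = m*n/n≡m m (suc n)

div-positive : ∀ {m n} → 1 ≤ n → n ≤ m → 0 < div m n
div-positive {n = suc n} _ n≤m = m≥n⇒m/n>0 n≤m

ceilDiv-1 : ∀ r → ceilDiv r 1 ≡ r
ceilDiv-1 r = trans (n/1≡n (r + 0)) (+-identityʳ r)

≤ceilDiv∸1⇒*< : ∀ {r s l} → 1 ≤ l → 0 < r → s ≤ ceilDiv r l ∸ 1 → s * l < r
≤ceilDiv∸1⇒*< {suc r} {s} {suc l} _ _ s≤q∸1 = s≤s (begin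
  s * suc l              ≤⟨ *-monoˡ-≤ (suc l) s≤q∸1 ⟩
  (q ∸ 1) * suc l        ≡⟨ *-distribʳ-∸ (suc l) q 1 ⟩
  q * suc l ∸ 1 * suc l  ≤⟨ ∸-monoˡ-≤ (1 * suc l) (m/n*n≤m (suc r + l) (suc l)) ⟩
  suc r + l ∸ 1 * suc l  ≡⟨ cong (r + l ∸_) (+-identityʳ l) ⟩
  r + l ∸ l              ≡⟨ m+n∸n≡m r l ⟩
  r                      ∎)
  where
  open ≤-Reasoning
  q : ℕ
  q = ceilDiv (suc r) (suc l)

module _ {v k lam : ℕ} (D : Design v k lam) where
  open Design D

  degree : Fin v → ℕ
  degree x = ∑[ i < b ] indicator (lookup (block i) x)

  ∣blocksThrough∣≡∑ : ∀ x y →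
    ∣ blocksThrough x y ∣ ≡ ∑[ i < b ] indicator (lookup (block i) x ∧ lookup (block i) y)
  ∣blocksThrough∣≡∑ x y =
    trans (∣p∣≡∑indicator (blocksThrough x y))
          (sum-cong-≗ (λ i → cong indicator (lookup∘tabulate both∈ i)))
    where
    both∈ : Fin b → Bool
    both∈ j = lookup (block j) x ∧ lookup (block j) y

  ∑∣blocksThrough∣≡degree*k : ∀ x → ∑[ y < v ] ∣ blocksThrough x y ∣ ≡ degree x * k
  ∑∣blocksThrough∣≡degree*k x = begin
    ∑[ y < v ] ∣ blocksThrough x y ∣                 ≡⟨ sum-cong-≗ (∣blocksThrough∣≡∑ x) ⟩
    ∑[ y < v ] ∑[ i < b ] indicator (x∈ i ∧ y∈ i y)  ≡⟨ ∑-comm (λ y i → indicator (x∈ i ∧ y∈ i y)) ⟩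
    ∑[ i < b ] ∑[ y < v ] indicator (x∈ i ∧ y∈ i y)  ≡⟨ sum-cong-≗ pull-out ⟩
    ∑[ i < b ] (indicator (x∈ i) * k)                ≡⟨ *-distribʳ-sum k (λ i → indicator (x∈ i)) ⟨
    degree x * k                                     ∎
    where
    open ≡-Reasoning
    x∈ : Fin b → Bool
    x∈ i = lookup (block i) x
    y∈ : Fin b → Fin v → Bool
    y∈ i y = lookup (block i) y
    pull-out : ∀ i → ∑[ y < v ] indicator (x∈ i ∧ y∈ i y) ≡ indicator (x∈ i) * k
    pull-out i = begin
      ∑[ y < v ] indicator (x∈ i ∧ y∈ i y)                ≡⟨ sum-cong-≗ (λ y → indicator-∧ (x∈ i) (y∈ i y)) ⟩
      ∑[ y < v ] (indicator (x∈ i) * indicator (y∈ i y))  ≡⟨ *-distribˡ-sum (indicator (x∈ i)) (λ y → indicator (y∈ i y)) ⟨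
      indicator (x∈ i) * ∑[ y < v ] indicator (y∈ i y)    ≡⟨ cong (indicator (x∈ i) *_) (sym (∣p∣≡∑indicator (block i))) ⟩
      indicator (x∈ i) * ∣ block i ∣                      ≡⟨ cong (indicator (x∈ i) *_) (blockSize i) ⟩
      indicator (x∈ i) * k                                ∎

  ∑∣blocksThrough∣≡degree+ : ∀ x → ∑[ y < v ] ∣ blocksThrough x y ∣ ≡ degree x + (v ∸ 1) * lam
  ∑∣blocksThrough∣≡degree+ x =
    trans (sum-constExcept _ x lam (λ y y≢x → balanced x y (λ x≡y → y≢x (sym x≡y))))
          (cong (_+ (v ∸ 1) * lam) (trans (∣blocksThrough∣≡∑ x x)
            (sum-cong-≗ (λ i → cong indicator (∧-idem (lookup (block i) x))))))

  degree*[k∸1]≡lam*[v∸1] : ∀ x → degree x * (k ∸ 1) ≡ lam * (v ∸ 1)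
  degree*[k∸1]≡lam*[v∸1] x = begin
    degree x * (k ∸ 1)                           ≡⟨ *-distribˡ-∸ (degree x) k 1 ⟩
    degree x * k ∸ degree x * 1                  ≡⟨ cong₂ _∸_ (sym (∑∣blocksThrough∣≡degree*k x)) (*-identityʳ (degree x)) ⟩
    ∑[ y < v ] ∣ blocksThrough x y ∣ ∸ degree x  ≡⟨ cong (_∸ degree x) (∑∣blocksThrough∣≡degree+ x) ⟩
    degree x + (v ∸ 1) * lam ∸ degree x          ≡⟨ m+n∸m≡n (degree x) _ ⟩
    (v ∸ 1) * lam                                ≡⟨ *-comm (v ∸ 1) lam ⟩
    lam * (v ∸ 1)                                ∎
    where open ≡-Reasoning

  k∸1≥1 : 1 ≤ k ∸ 1
  k∸1≥1 = ∸-monoˡ-≤ 1 k≥2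

  replication≡degree : ∀ x → replication v k lam ≡ degree x
  replication≡degree x = trans (cong (λ m → div m (k ∸ 1)) (sym (degree*[k∸1]≡lam*[v∸1] x)))
                               (div-*-cancelʳ (degree x) k∸1≥1)

  replication-positive : 0 < replication v k lam
  replication-positive = div-positive k∸1≥1 (begin
    k ∸ 1          ≤⟨ ∸-monoˡ-≤ 1 k≤v ⟩
    v ∸ 1          ≡⟨ *-identityˡ (v ∸ 1) ⟨
    1 * (v ∸ 1)    ≤⟨ *-monoˡ-≤ (v ∸ 1) lam≥1 ⟩
    lam * (v ∸ 1)  ∎)
    where open ≤-Reasoning

  degree≤∣P∣*lam : ∀ P x → x ∉ P → (∀ i → x ∈ block i → Nonempty (block i ∩ P)) →
                   degree x ≤ ∣ P ∣ * lam
  degree≤∣P∣*lam P x x∉P meets = begin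
    degree x                                    ≤⟨ sum-mono-≤ covered ⟩
    ∑[ i < b ] ∑[ p < v ] flag i p              ≡⟨ ∑-comm flag ⟩
    ∑[ p < v ] ∑[ i < b ] flag i p              ≡⟨ sum-cong-≗ (λ p → *-distribˡ-sum (p∈P p) (λ i → xp∈ i p)) ⟨
    ∑[ p < v ] (p∈P p * ∑[ i < b ] xp∈ i p)     ≡⟨ sum-cong-≗ (λ p → cong (p∈P p *_) (∣blocksThrough∣≡∑ x p)) ⟨
    ∑[ p < v ] (p∈P p * ∣ blocksThrough x p ∣)  ≡⟨ sum-cong-≗ shared ⟩
    ∑[ p < v ] (p∈P p * lam)                    ≡⟨ *-distribʳ-sum lam p∈P ⟨
    (∑[ p < v ] p∈P p) * lam                    ≡⟨ cong (_* lam) (∣p∣≡∑indicator P) ⟨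
    ∣ P ∣ * lam                                 ∎
    where
    open ≤-Reasoning
    p∈P : Fin v → ℕ
    p∈P p = indicator (lookup P p)
    xp∈ : Fin b → Fin v → ℕ
    xp∈ i p = indicator (lookup (block i) x ∧ lookup (block i) p)
    flag : Fin b → Fin v → ℕ
    flag i p = p∈P p * xp∈ i p

    flag≡1 : ∀ {i p} → lookup (block i) x ≡ true → p ∈ block i ∩ P → flag i p ≡ 1
    flag≡1 {i} {p} x∈Bᵢ p∈Bᵢ∩P
      rewrite []=⇒lookup (proj₂ (x∈p∩q⁻ (block i) P p∈Bᵢ∩P))
            | x∈Bᵢ
            | []=⇒lookup (proj₁ (x∈p∩q⁻ (block i) P p∈Bᵢ∩P)) = refl

    covered : ∀ i → indicator (lookup (block i) x) ≤ ∑[ p < v ] flag i p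
    covered i = indicator≤sum _ (flag i) λ x∈Bᵢ →
      let p , p∈Bᵢ∩P = meets i (lookup⇒[]= x (block i) x∈Bᵢ) in p , flag≡1 x∈Bᵢ p∈Bᵢ∩P

    shared : ∀ p → p∈P p * ∣ blocksThrough x p ∣ ≡ p∈P p * lam
    shared p with lookup P p in p∈P′
    ... | false = refl
    ... | true  = cong (1 *_) (balanced x p λ { refl → x∉P (lookup⇒[]= p P p∈P′) })

  dominating-I : ∀ P → ∣ P ∣ * lam < replication v k lam → Dominating D (I D P)
  dominating-I P ∣P∣λ<r (inj₁ x) with x ∈? P
  ... | yes x∈P = inj₁ x∈P
  ... | no x∉P with any? (λ i → x ∈? block i ×-dec ¬? (nonempty? (block i ∩ P)))
  ...   | yes (i , x∈Bᵢ , Bᵢ∩P-empty) = inj₂ (inj₂ i , Bᵢ∩P-empty , x∈Bᵢ)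
  ...   | no ∄avoiding = ⊥-elim (<⇒≱ ∣P∣λ<r (begin
    replication v k lam  ≡⟨ replication≡degree x ⟩
    degree x             ≤⟨ degree≤∣P∣*lam P x x∉P meets ⟩
    ∣ P ∣ * lam          ∎))
    where
    open ≤-Reasoning
    meets : ∀ i → x ∈ block i → Nonempty (block i ∩ P)
    meets i x∈Bᵢ = decidable-stable (nonempty? (block i ∩ P)) (λ empty → ∄avoiding (i , x∈Bᵢ , empty))
  dominating-I P _ (inj₂ i) with nonempty? (block i ∩ P)
  ... | no Bᵢ∩P-empty = inj₁ Bᵢ∩P-empty
  ... | yes (p , p∈Bᵢ∩P) = inj₂ (inj₁ p , proj₂ (x∈p∩q⁻ (block i) P p∈Bᵢ∩P) , proj₁ (x∈p∩q⁻ (block i) P p∈Bᵢ∩P))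

lemma3p1 : ∀ {v k lam : ℕ} (D : Design v k lam)
    → ((P : Subset v) → ∣ P ∣ ≤ ceilDiv (replication v k lam) lam ∸ 1 → Dominating D (I D P))
      × (lam ≡ 1 → (P : Subset v) → ∣ P ∣ ≤ replication v k lam ∸ 1 → Dominating D (I D P))
lemma3p1 {v} {k} {lam} D = small-P-dominates , λ { refl P → small-P-dominates P ∘ ≤ceilDiv-1 }
  where
  r : ℕ
  r = replication v k lam
  small-P-dominates : ∀ P → ∣ P ∣ ≤ ceilDiv r lam ∸ 1 → Dominating D (I D P)
  small-P-dominates P ∣P∣≤ = dominating-I D P (≤ceilDiv∸1⇒*< (Design.lam≥1 D) (replication-positive D) ∣P∣≤)
  ≤ceilDiv-1 : ∀ {s} → s ≤ r ∸ 1 → s ≤ ceilDiv r 1 ∸ 1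
  ≤ceilDiv-1 {s} = subst (λ c → s ≤ c ∸ 1) (sym (ceilDiv-1 r))
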